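{- If $w\in\mathfrak{S}_n$ is a Grassmannian permutation of shape $\lambda$, then the interval $[e,w]$ in the right weak Bruhat order is isomorphic to the dual $[\varnothing,\lambda]^*$ of the interval $[\varnothing,\lambda]$ in Young's lattice.
   Context: Right weak Bruhat order on $\mathfrak{S}_n$: transitive closure of $u\lessdot w$ when $w=u\sigma_i$ with $\sigma_i=(i,i+1)$ and $u(i)<u(i+1)$. $w$ is Grassmannian if it has at most one descent ($w(i)>w(i+1)$ for at most one $i$). The shape of $w$ is the weakly decreasing rearrangement of its Lehmer code $c(w)$, $c_i(w)=\#\{j>i:w(i)>w(j)\}$. Young's lattice orders partitions by containment of Ferrers diagrams; $P^*$ denotes the dual poset. -}

module Defs where

open import Level using (0ℓ)
open import Data.Nat as ℕ using (ℕ; suc)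
open import Data.Fin as Fin using (Fin; toℕ)
open import Data.Fin.Properties using (_<?_)
open import Data.Vec using (Vec; lookup; allFin; count; toList)
open import Data.Product using (Σ; _×_; proj₁)
open import Data.List.Relation.Binary.Permutation.Propositional using (_↭_)
open import Relation.Binary using (Rel)
open import Relation.Binary.PropositionalEquality using (_≡_; _≢_)
open import Relation.Binary.Construct.Closure.ReflexiveTransitive using (Star)
open import Relation.Nullary.Decidable using (_×-dec_)
open import Function.Definitions using (Injective)

-- A permutation w ∈ 𝔖_n is given in one-line notation as a vector
-- (w(0), …, w(n-1)) of elements of Fin n (positions/values 0-indexed).
Word : ℕ → Set
Word n = Vec (Fin n) n

IsPerm : ∀ {n} → Word n → Set
IsPerm w = Injective _≡_ _≡_ (lookup w)

e : ∀ n → Word n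
e n = allFin n

-- Cover relation of right weak order: u ⋖ w iff w = u σ_i with u(i) < u(i+1),
-- i.e. w is u with the entries in positions i, i+1 swapped, and u(i) < u(i+1).
_⋖_ : ∀ {n} → Rel (Word n) 0ℓ
_⋖_ {n} u w = Σ (Fin n) λ i → Σ (Fin n) λ j →
  (toℕ j ≡ suc (toℕ i)) × (lookup u i Fin.< lookup u j) ×
  (lookup w i ≡ lookup u j) × (lookup w j ≡ lookup u i) ×
  (∀ k → k ≢ i → k ≢ j → lookup w k ≡ lookup u k)

_≤R_ : ∀ {n} → Rel (Word n) 0ℓ
_≤R_ = Star _⋖_

Descent : ∀ {n} → Word n → Fin n → Set
Descent {n} w i = Σ (Fin n) λ j → (toℕ j ≡ suc (toℕ i)) × (lookup w j Fin.< lookup w i)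

Grassmannian : ∀ {n} → Word n → Set
Grassmannian {n} w = ∀ i i' → Descent w i → Descent w i' → i ≡ i'

code : ∀ {n} → Word n → Vec ℕ n
code {n} w = Data.Vec.tabulate λ i →
  count (λ j → (i <? j) ×-dec (lookup w j <? lookup w i)) (allFin n)

-- weakly decreasing vectors of naturals: partitions with at most n parts,
-- padded with zeros to length n
Decreasing : ∀ {n} → Vec ℕ n → Set
Decreasing {n} μ = ∀ (i j : Fin n) → i Fin.≤ j → lookup μ j ℕ.≤ lookup μ i

IsShape : ∀ {n} → Word n → Vec ℕ n → Set
IsShape w λ′ = Decreasing λ′ × (toList λ′ ↭ toList (code w))

_⊆Y_ : ∀ {n} → Rel (Vec ℕ n) 0ℓ
_⊆Y_ {n} μ ν = ∀ (i : Fin n) → lookup μ i ℕ.≤ lookup ν i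

WeakInterval : ∀ n → Word n → Set
WeakInterval n w = Σ (Word n) λ u → (e n ≤R u) × (u ≤R w)

-- interval [∅,λ] in Young's lattice (∅ ⊆ μ always holds, padded with zeros)
YoungInterval : ∀ n → Vec ℕ n → Set
YoungInterval n λ′ = Σ (Vec ℕ n) λ μ → Decreasing μ × (μ ⊆Y λ′)

_≈W_ : ∀ {n w} → Rel (WeakInterval n w) 0ℓ
x ≈W y = proj₁ x ≡ proj₁ y

_≤W_ : ∀ {n w} → Rel (WeakInterval n w) 0ℓ
_≤W_ {n} x y = _≤R_ {n} (proj₁ x) (proj₁ y)

_≈Y_ : ∀ {n λ′} → Rel (YoungInterval n λ′) 0ℓ
x ≈Y y = proj₁ x ≡ proj₁ y

_≤Y_ : ∀ {n λ′} → Rel (YoungInterval n λ′) 0ℓ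
_≤Y_ {n} x y = _⊆Y_ {n} (proj₁ x) (proj₁ y)

_≤Y*_ : ∀ {n λ′} → Rel (YoungInterval n λ′) 0ℓ
_≤Y*_ {n} {λ′} x y = _≤Y_ {n} {λ′} y x

-- Write w = as ++ bs with as and bs increasing, which is possible since w has at most one
-- descent.  The words weakly below w are the shuffles of as and bs in which a letter of bs
-- precedes a letter of as only if it is smaller, and such a shuffle is determined by the
-- number c(a) of letters of bs in front of each a.  These numbers increase weakly along as and
-- are bounded by β(a) = #{b < a}, the entries of the Lehmer code of w, so c read backwards is a
-- partition inside λ = shape(w), and every such partition occurs.  A cover step upwards swaps
-- adjacent letters b a with b < a and lowers one c(a) by one; conversely, if c′ ≤ c pointwise
-- and c′ ≠ c, then swapping the first a with c(a) > c′(a) with the b just in front of it is a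
-- cover step that keeps c′ ≤ c.  Hence u ≤ u′ in the weak order exactly when c(u′) ≤ c(u).
module Submission where

open import Defs
open import Level using (0ℓ)
open import Data.Bool using (true; false)
open import Data.Empty using (⊥-elim)
open import Data.Fin as Fin using (Fin; toℕ; zero; suc)
import Data.Fin.Properties as Fin
open import Data.List as List using (List; []; _∷_; _++_; length; map; replicate; reverse)
import Data.List.Properties as List
open import Data.List.Relation.Binary.Disjoint.Propositional using (Disjoint; contractₗ; contractᵣ)
import Data.List.Relation.Binary.Disjoint.Propositional.Properties as Disjoint
open import Data.List.Relation.Binary.Permutation.Propositional as Perm using (_↭_; ↭-sym)
import Data.List.Relation.Binary.Permutation.Propositional.Properties as Perm
open import Data.List.Relation.Binary.Pointwise as Pointwise using (Pointwise; []; _∷_)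
import Data.List.Relation.Binary.Sublist.Propositional as Sublist
import Data.List.Relation.Binary.Sublist.Propositional.Properties as Sublist
open import Data.List.Relation.Unary.All as All using (All; []; _∷_)
import Data.List.Relation.Unary.All.Properties as All
open import Data.List.Relation.Unary.AllPairs as AllPairs using (AllPairs; []; _∷_)
import Data.List.Relation.Unary.AllPairs.Properties as AllPairs
open import Data.List.Relation.Unary.Any using (here; there)
import Data.List.Relation.Unary.Sorted.TotalOrder.Properties as Sorted
open import Data.List.Relation.Unary.Unique.Propositional using (Unique)
open import Data.Nat as ℕ using (ℕ; zero; suc; _+_; z≤n; s≤s; _≤_; _<_)
open import Data.Nat.Induction using (<-wellFounded)
open import Data.Nat.ListAction using (sum)
import Data.Nat.Properties as ℕ
open import Data.Product using (Σ; Σ-syntax; ∃; ∃₂; _×_; _,_; proj₁; proj₂)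
open import Data.Vec as Vec using (Vec; []; _∷_; lookup)
import Data.Vec.Properties as Vec
import Data.Vec.Relation.Unary.All.Properties as VecAll
open import Function using (_∘_; id; case_of_; flip)
open import Function.Definitions using (Injective)
open import Induction.WellFounded using (Acc; acc)
open import Relation.Binary using (Rel; tri<; tri≈; tri>)
open import Relation.Binary.Construct.Closure.ReflexiveTransitive using (Star; ε; _◅_)
open import Relation.Binary.Morphism.Structures using (IsOrderIsomorphism)
open import Relation.Binary.Properties.TotalOrder ℕ.≤-totalOrder using (≥-totalOrder)
open import Relation.Binary.PropositionalEquality
open import Relation.Nullary using (¬_; yes; no; does)
open import Relation.Nullary.Decidable using (_×-dec_)
open import Relation.Unary using (Pred; Decidable)

private variable
  N m : ℕ
  x y : ℕ
  xs ys : List ℕ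

NonDecreasing : List ℕ → Set
NonDecreasing = AllPairs _≤_

NonIncreasing : List ℕ → Set
NonIncreasing = AllPairs (λ x y → y ≤ x)

infix 4 _⊑_
_⊑_ : Rel (List ℕ) 0ℓ
_⊑_ = Pointwise _≤_

⊑-refl : xs ⊑ xs
⊑-refl = Pointwise.refl ℕ.≤-refl

⊑-trans : ∀ {zs} → xs ⊑ ys → ys ⊑ zs → xs ⊑ zs
⊑-trans = Pointwise.transitive ℕ.≤-trans

map-suc-⊑ : xs ⊑ ys → map suc xs ⊑ map suc ys
map-suc-⊑ = Pointwise.map⁺ suc suc ∘ Pointwise.map s≤s

map-suc-⊑⁻ : map suc xs ⊑ map suc ys → xs ⊑ ys
map-suc-⊑⁻ = Pointwise.map ℕ.≤-pred ∘ Pointwise.map⁻ suc suc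

[]⊑⇒≡[] : [] ⊑ xs → xs ≡ []
[]⊑⇒≡[] [] = refl

replicate-0-⊑ : ∀ xs → replicate (length xs) 0 ⊑ xs
replicate-0-⊑ []       = []
replicate-0-⊑ (x ∷ xs) = z≤n ∷ replicate-0-⊑ xs

⊑-replicate-0 : ∀ q → xs ⊑ replicate q 0 → xs ≡ replicate q 0
⊑-replicate-0 zero    []          = refl
⊑-replicate-0 (suc q) (z≤n ∷ xs⊑) = cong (0 ∷_) (⊑-replicate-0 q xs⊑)

⊑-++⁻ : ∀ {μ} xs ys → μ ⊑ xs ++ ys → ∃₂ λ μ₁ μ₂ → μ ≡ μ₁ ++ μ₂ × μ₁ ⊑ xs × μ₂ ⊑ ys
⊑-++⁻ []       _  μ⊑ = [] , _ , refl , [] , μ⊑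
⊑-++⁻ (x ∷ xs) ys (m≤x ∷ μ⊑) =
  let μ₁ , μ₂ , eq , μ₁⊑ , μ₂⊑ = ⊑-++⁻ xs ys μ⊑ in _ ∷ μ₁ , μ₂ , cong (_ ∷_) eq , m≤x ∷ μ₁⊑ , μ₂⊑

data Bump : Rel (List ℕ) 0ℓ where
  here  : Bump (x ∷ xs) (suc x ∷ xs)
  there : Bump xs ys → Bump (x ∷ xs) (x ∷ ys)

Bump⇒⊑ : Bump xs ys → xs ⊑ ys
Bump⇒⊑ (here {x}) = ℕ.n≤1+n x ∷ ⊑-refl
Bump⇒⊑ (there b)  = ℕ.≤-refl ∷ Bump⇒⊑ b

Bump-map-suc : Bump xs ys → Bump (map suc xs) (map suc ys)
Bump-map-suc here      = here
Bump-map-suc (there b) = there (Bump-map-suc b)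

Bump⇒sum< : Bump xs ys → sum xs < sum ys
Bump⇒sum< here               = ℕ.≤-refl
Bump⇒sum< {x ∷ xs} (there b) = ℕ.+-monoʳ-< x (Bump⇒sum< b)

positive⇒map-suc : NonDecreasing (suc x ∷ xs) → ∃ λ ys → suc x ∷ xs ≡ map suc ys
positive⇒map-suc {x} (x≤xs ∷ _) = x ∷ _ , cong (suc x ∷_) (proj₂ (all-positive x≤xs))
  where
  all-positive : ∀ {zs} → All (suc x ≤_) zs → ∃ λ ys → zs ≡ map suc ys
  all-positive []          = [] , refl
  all-positive (s≤s _ ∷ p) = let ys , eq = all-positive p in _ ∷ ys , cong (_ ∷_) eq

nonDecreasing-map-suc⁻ : NonDecreasing (map suc xs) → NonDecreasing xs
nonDecreasing-map-suc⁻ = AllPairs.map ℕ.≤-pred ∘ AllPairs.map⁻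

nonIncreasing-↭-unique : NonIncreasing xs → NonIncreasing ys → xs ↭ ys → xs ≡ ys
nonIncreasing-↭-unique ni ni′ xs↭ys = Pointwise.Pointwise-≡⇒≡
  (Sorted.↗↭↗⇒≋ ≥-totalOrder (Sorted.AllPairs⇒Sorted ≥-totalOrder ni)
    (Sorted.AllPairs⇒Sorted ≥-totalOrder ni′) (Perm.↭⇒↭ₛ xs↭ys))

AllPairs-++⁻ˡ : {A : Set} {R : Rel A 0ℓ} (xs : List A) {ys : List A} → AllPairs R (xs ++ ys) → AllPairs R xs
AllPairs-++⁻ˡ []       _        = []
AllPairs-++⁻ˡ (x ∷ xs) (r ∷ rs) = All.++⁻ˡ xs r ∷ AllPairs-++⁻ˡ xs rs

AllPairs-reverse : {A : Set} {R : Rel A 0ℓ} {xs : List A} → AllPairs R xs → AllPairs (flip R) (reverse xs)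
AllPairs-reverse {xs = []}     []       = []
AllPairs-reverse {xs = x ∷ xs} (r ∷ rs) rewrite List.unfold-reverse x xs =
  AllPairs.++⁺ (AllPairs-reverse rs) ([] ∷ [])
    (All.map (_∷ []) (Perm.All-resp-↭ (↭-sym (Perm.↭-reverse xs)) r))

unique-++⇒disjoint : {A : Set} (xs : List A) {ys : List A} → Unique (xs ++ ys) → Disjoint xs ys
unique-++⇒disjoint (x ∷ xs) (x∉ys ∷ _) (here refl , x∈ys)  = All.lookup (All.++⁻ʳ xs x∉ys) x∈ys refl
unique-++⇒disjoint (x ∷ xs) (_ ∷ u)    (there v∈xs , v∈ys) = unique-++⇒disjoint xs u (v∈xs , v∈ys)

lookup-ext : {A : Set} {u v : Vec A m} → (∀ k → lookup u k ≡ lookup v k) → u ≡ v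
lookup-ext {u = u} {v} u≗v = begin
  u                       ≡⟨ Vec.tabulate∘lookup u ⟨
  Vec.tabulate (lookup u) ≡⟨ Vec.tabulate-cong u≗v ⟩
  Vec.tabulate (lookup v) ≡⟨ Vec.tabulate∘lookup v ⟩
  v                       ∎
  where open ≡-Reasoning

toList-injective : {A : Set} {u v : Vec A m} → Vec.toList u ≡ Vec.toList v → u ≡ v
toList-injective {u = u} {v} eq = trans (sym (Vec.cast-is-id refl u)) (Vec.toList-injective refl u v eq)

vecOfLength : {A : Set} (xs : List A) → length xs ≡ m → Vec A m
vecOfLength xs refl = Vec.fromList xs

toList-vecOfLength : {A : Set} (xs : List A) (eq : length xs ≡ m) → Vec.toList (vecOfLength xs eq) ≡ xs
toList-vecOfLength xs refl = Vec.toList∘fromList xs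

module _ {A B : Set} {P : Pred A 0ℓ} {Q : Pred B 0ℓ} (P? : Decidable P) (Q? : Decidable Q) where

  count-map : (f : B → A) → (∀ b → does (P? (f b)) ≡ does (Q? b)) →
              (bs : Vec B m) → Vec.count P? (Vec.map f bs) ≡ Vec.count Q? bs
  count-map f same []       = refl
  count-map f same (b ∷ bs) rewrite same b with does (Q? b)
  ... | true  = cong suc (count-map f same bs)
  ... | false = count-map f same bs

count-allFin-suc : {P : Pred (Fin (suc m)) 0ℓ} {Q : Pred (Fin m) 0ℓ} (P? : Decidable P) (Q? : Decidable Q) →
                   does (P? zero) ≡ false → (∀ j → does (P? (suc j)) ≡ does (Q? j)) →
                   Vec.count P? (Vec.allFin (suc m)) ≡ Vec.count Q? (Vec.allFin m)
count-allFin-suc {m} P? Q? P?0 same rewrite P?0 =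
  trans (cong (Vec.count P?) (Vec.tabulate-∘ suc id)) (count-map P? Q? suc same (Vec.allFin m))

count-lookup : {A : Set} {P : Pred A 0ℓ} (P? : Decidable P) (v : Vec A m) →
               Vec.count (P? ∘ lookup v) (Vec.allFin m) ≡ Vec.count P? v
count-lookup {m} P? v =
  trans (sym (count-map P? (P? ∘ lookup v) (lookup v) (λ _ → refl) (Vec.allFin m)))
        (cong (Vec.count P?) (Vec.map-lookup-allFin v))

count≡length-filter : {A : Set} {P : Pred A 0ℓ} (P? : Decidable P) (v : Vec A m) →
                      Vec.count P? v ≡ length (List.filter P? (Vec.toList v))
count≡length-filter P? []      = refl
count≡length-filter P? (x ∷ v) with does (P? x)
... | true  = cong suc (count≡length-filter P? v)
... | false = count≡length-filter P? v

-- The cover relation _⋖_ of Defs for words of any length m over any alphabet Fin N, so that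
-- it can be analysed by recursion on words; for N = m it is _⋖_ itself.  The same goes for
-- DescentAt, AtMostOneDescent and lehmerCode below.
_⋖ᵛ_ : Rel (Vec (Fin N) m) 0ℓ
_⋖ᵛ_ {N} {m} u w = Σ (Fin m) λ i → Σ (Fin m) λ j →
  (toℕ j ≡ suc (toℕ i)) × (lookup u i Fin.< lookup u j) ×
  (lookup w i ≡ lookup u j) × (lookup w j ≡ lookup u i) ×
  (∀ k → k ≢ i → k ≢ j → lookup w k ≡ lookup u k)

data SwapAscent {N} : Rel (Vec (Fin N) m) 0ℓ where
  here  : ∀ {a b} {w : Vec (Fin N) m} → a Fin.< b → SwapAscent (a ∷ b ∷ w) (b ∷ a ∷ w)
  there : ∀ {a} {u v : Vec (Fin N) m} → SwapAscent u v → SwapAscent (a ∷ u) (a ∷ v)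

⋖ᵛ⇒swapAscent : (u v : Vec (Fin N) m) → u ⋖ᵛ v → SwapAscent u v
⋖ᵛ⇒swapAscent (a ∷ b ∷ w) (_ ∷ _ ∷ w′) (zero , suc zero , _ , a<b , refl , refl , rest)
  rewrite lookup-ext {u = w′} {w} (λ k → rest (suc (suc k)) (λ ()) (λ ())) = here a<b
⋖ᵛ⇒swapAscent (a ∷ u) (_ ∷ v) (suc i , suc j , j≡1+i , a<b , vi , vj , rest)
  rewrite rest zero (λ ()) (λ ()) =
  there (⋖ᵛ⇒swapAscent u v (i , j , ℕ.suc-injective j≡1+i , a<b , vi , vj ,
    λ k k≢i k≢j → rest (suc k) (k≢i ∘ Fin.suc-injective) (k≢j ∘ Fin.suc-injective)))
⋖ᵛ⇒swapAscent _ _ (zero , zero , () , _)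
⋖ᵛ⇒swapAscent _ _ (zero , suc (suc _) , () , _)
⋖ᵛ⇒swapAscent _ _ (suc _ , zero , () , _)

swapAscent⇒⋖ᵛ : {u v : Vec (Fin N) m} → SwapAscent u v → u ⋖ᵛ v
swapAscent⇒⋖ᵛ (here {a = a} {b = b} {w = w} a<b) = zero , suc zero , refl , a<b , refl , refl , rest
  where
  rest : ∀ k → k ≢ zero → k ≢ suc zero → lookup (b ∷ a ∷ w) k ≡ lookup (a ∷ b ∷ w) k
  rest zero          k≢0 _   = ⊥-elim (k≢0 refl)
  rest (suc zero)    _   k≢1 = ⊥-elim (k≢1 refl)
  rest (suc (suc k)) _   _   = refl
swapAscent⇒⋖ᵛ (there {a = a} {u = u} {v = v} s) with swapAscent⇒⋖ᵛ s
... | i , j , j≡1+i , a<b , vi , vj , rest = suc i , suc j , cong suc j≡1+i , a<b , vi , vj , rest′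
  where
  rest′ : ∀ k → k ≢ suc i → k ≢ suc j → lookup (a ∷ v) k ≡ lookup (a ∷ u) k
  rest′ zero    _   _   = refl
  rest′ (suc k) k≢i k≢j = rest k (k≢i ∘ cong suc) (k≢j ∘ cong suc)

module _ {N : ℕ} where

  private variable
    a b : Fin N
    as bs : List (Fin N)
    u v : Vec (Fin N) m

  Ascending : List (Fin N) → Set
  Ascending = AllPairs Fin._<_

  -- Shuffles

  -- For increasing as and bs, the words weakly below as ++ bs: interleavings of as and bs
  -- that put a letter b in front of the remaining as only when b is smaller than all of them.
  data Shuffle : List (Fin N) → List (Fin N) → Vec (Fin N) m → Set where
    []    : Shuffle [] [] []
    left  : Shuffle as bs u → Shuffle (a ∷ as) bs (a ∷ u)
    right : All (b Fin.<_) as → Shuffle as bs u → Shuffle as (b ∷ bs) (b ∷ u)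

  bsBefore : Shuffle as bs u → List ℕ
  bsBefore []          = []
  bsBefore (left d)    = 0 ∷ bsBefore d
  bsBefore (right _ d) = map suc (bsBefore d)

  bsBefore-length : (d : Shuffle as bs u) → length (bsBefore d) ≡ length as
  bsBefore-length []          = refl
  bsBefore-length (left d)    = cong suc (bsBefore-length d)
  bsBefore-length (right _ d) = trans (List.length-map suc (bsBefore d)) (bsBefore-length d)

  bsBefore-nondecreasing : (d : Shuffle as bs u) → NonDecreasing (bsBefore d)
  bsBefore-nondecreasing []          = []
  bsBefore-nondecreasing (left d)    = All.universal (λ _ → z≤n) _ ∷ bsBefore-nondecreasing d
  bsBefore-nondecreasing (right _ d) = AllPairs.map⁺ (AllPairs.map s≤s (bsBefore-nondecreasing d))

  bsBefore-noAs : (d : Shuffle [] bs u) → bsBefore d ≡ []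
  bsBefore-noAs []          = refl
  bsBefore-noAs (right _ d) = cong (map suc) (bsBefore-noAs d)

  bsBefore-nonempty : (d : Shuffle (a ∷ as) bs u) → ∃₂ λ x xs → bsBefore d ≡ x ∷ xs
  bsBefore-nonempty (left d)    = 0 , bsBefore d , refl
  bsBefore-nonempty (right _ d) =
    let x , xs , eq = bsBefore-nonempty d in suc x , map suc xs , cong (map suc) eq

  shuffle-length : {u : Vec (Fin N) m} → Shuffle as bs u → m ≡ length as + length bs
  shuffle-length []                    = refl
  shuffle-length (left d)              = cong suc (shuffle-length d)
  shuffle-length {as = as} (right _ d) = trans (cong suc (shuffle-length d)) (sym (ℕ.+-suc (length as) _))

  concatenation-shuffle : (v : Vec (Fin N) m) → Vec.toList v ≡ as ++ bs →
                          Σ[ d ∈ Shuffle as bs v ] bsBefore d ≡ replicate (length as) 0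
  concatenation-shuffle {as = []} {[]} [] _ = [] , refl
  concatenation-shuffle {as = []} {b ∷ bs} (x ∷ v) eq with refl ← List.∷-injectiveˡ eq =
    let d , zeros = concatenation-shuffle v (List.∷-injectiveʳ eq) in right [] d , cong (map suc) zeros
  concatenation-shuffle {as = a ∷ as} (x ∷ v) eq with refl ← List.∷-injectiveˡ eq =
    let d , zeros = concatenation-shuffle v (List.∷-injectiveʳ eq) in left d , cong (0 ∷_) zeros

  swapAscent-lowers : Ascending as → Ascending bs → SwapAscent u v → (dv : Shuffle as bs v) →
                      Σ[ du ∈ Shuffle as bs u ] Bump (bsBefore dv) (bsBefore du)
  swapAscent-lowers ((y<x ∷ _) ∷ _) _ (here x<y) (left (left _))          = ⊥-elim (Fin.<-asym x<y y<x)
  swapAscent-lowers _ _               (here x<y) (left (right b<as d))   = right (x<y ∷ b<as) (left d) , here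
  swapAscent-lowers _ _               (here x<y) (right (y<x ∷ _) (left _)) = ⊥-elim (Fin.<-asym x<y y<x)
  swapAscent-lowers _ ((y<x ∷ _) ∷ _) (here x<y) (right _ (right _ _))   = ⊥-elim (Fin.<-asym x<y y<x)
  swapAscent-lowers (_ ∷ <as) <bs (there s) (left dv) =
    let du , bump = swapAscent-lowers <as <bs s dv in left du , there bump
  swapAscent-lowers <as (_ ∷ <bs) (there s) (right b<as dv) =
    let du , bump = swapAscent-lowers <as <bs s dv in right b<as du , Bump-map-suc bump

  shuffle-below : Ascending as → Ascending bs → Star _⋖ᵛ_ u v → (dv : Shuffle as bs v) →
                  Σ[ du ∈ Shuffle as bs u ] bsBefore dv ⊑ bsBefore du
  shuffle-below _ _ ε dv = dv , ⊑-refl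
  shuffle-below {u = u} <as <bs (u⋖w ◅ w≤v) dv =
    let dw , dv⊑dw = shuffle-below <as <bs w≤v dv
        du , bump  = swapAscent-lowers <as <bs (⋖ᵛ⇒swapAscent u _ u⋖w) dw
    in du , ⊑-trans dv⊑dw (Bump⇒⊑ bump)

  bsBefore-unique : Disjoint as bs → (d d′ : Shuffle as bs u) → bsBefore d ≡ bsBefore d′
  bsBefore-unique _     []          []           = refl
  bsBefore-unique as#bs (left d)    (left d′)    = cong (0 ∷_) (bsBefore-unique (contractₗ as#bs) d d′)
  bsBefore-unique as#bs (left _)    (right _ _)  = ⊥-elim (as#bs (here refl , here refl))
  bsBefore-unique as#bs (right _ _) (left _)     = ⊥-elim (as#bs (here refl , here refl))
  bsBefore-unique as#bs (right _ d) (right _ d′) = cong (map suc) (bsBefore-unique (contractᵣ as#bs) d d′)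

  bsBefore-injective : (d : Shuffle as bs u) (d′ : Shuffle as bs v) → bsBefore d ≡ bsBefore d′ → u ≡ v
  bsBefore-injective [] [] _ = refl
  bsBefore-injective (left d) (left d′) eq = cong (_ ∷_) (bsBefore-injective d d′ (List.∷-injectiveʳ eq))
  bsBefore-injective (left _) (right _ d′) eq with _ , _ , eq′ ← bsBefore-nonempty d′
    with () ← trans eq (cong (map suc) eq′)
  bsBefore-injective (right _ d) (left _) eq with _ , _ , eq′ ← bsBefore-nonempty d
    with () ← trans (sym eq) (cong (map suc) eq′)
  bsBefore-injective (right _ d) (right _ d′) eq =
    cong (_ ∷_) (bsBefore-injective d d′ (List.map-injective ℕ.suc-injective eq))

  -- Swaps the last b in front of the first a with that a.
  swap-into-first : (b<as : All (b Fin.<_) (a ∷ as)) (d : Shuffle (a ∷ as) bs u) →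
    Σ[ v ∈ Vec (Fin N) (suc m) ] SwapAscent (b ∷ u) v × Σ[ dv ∈ Shuffle (a ∷ as) (b ∷ bs) v ]
      ∃₂ λ x xs → bsBefore dv ≡ x ∷ xs × bsBefore (right b<as d) ≡ suc x ∷ xs
  swap-into-first (b<a ∷ b<as) (left d) = _ , here b<a , left (right b<as d) , 0 , _ , refl , refl
  swap-into-first {b = b} b<as (right b′<as d) =
    let v , s , dv , x , xs , eq , eq′ = swap-into-first b′<as d
    in b ∷ v , there s , right b<as dv , suc x , map suc xs , cong (map suc) eq , cong (map suc) eq′

  step-up : (du : Shuffle as bs u) (c : List ℕ) → NonDecreasing c → c ⊑ bsBefore du → c ≢ bsBefore du →
            Σ[ v ∈ Vec (Fin N) m ] SwapAscent u v × Σ[ dv ∈ Shuffle as bs v ]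
              Bump (bsBefore dv) (bsBefore du) × c ⊑ bsBefore dv
  step-up du [] _ c⊑ c≢ = ⊥-elim (c≢ (sym ([]⊑⇒≡[] c⊑)))
  step-up (left du) (0 ∷ c) (_ ∷ nd) (z≤n ∷ c⊑) c≢ =
    let v , s , dv , bump , c⊑dv = step-up du c nd c⊑ (c≢ ∘ cong (0 ∷_))
    in _ , there s , left dv , there bump , z≤n ∷ c⊑dv
  step-up (right {as = []} _ du) (_ ∷ _) _ c⊑ _
    with () ← subst (_ ⊑_) (cong (map suc) (bsBefore-noAs du)) c⊑
  step-up (right {as = _ ∷ _} b<as du) (0 ∷ c) _ c⊑ _ =
    let v , s , dv , x , xs , eq , eq′ = swap-into-first b<as du
    in v , s , dv , subst₂ Bump (sym eq) (sym eq′) here ,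
       subst (_ ⊑_) (sym eq) (z≤n ∷ Pointwise.tail (subst (_ ⊑_) eq′ c⊑))
  step-up (right b<as du) c@(suc _ ∷ _) nd c⊑ c≢ =
    let c₀ , c≡ = positive⇒map-suc nd
        v , s , dv , bump , c₀⊑dv = step-up du c₀ (nonDecreasing-map-suc⁻ (subst NonDecreasing c≡ nd))
          (map-suc-⊑⁻ (subst (_⊑ _) c≡ c⊑)) (c≢ ∘ trans c≡ ∘ cong (map suc))
    in _ , there s , right b<as dv , Bump-map-suc bump ,
       subst (_⊑ map suc (bsBefore dv)) (sym c≡) (map-suc-⊑ c₀⊑dv)

  bsBefore-⊑⇒≤R : (du : Shuffle as bs u) (dv : Shuffle as bs v) → bsBefore dv ⊑ bsBefore du → Star _⋖ᵛ_ u v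
  bsBefore-⊑⇒≤R {as = as} {bs = bs} {v = v} du dv = climb du (<-wellFounded _)
    where
    climb : ∀ {u} (du : Shuffle as bs u) → Acc _<_ (sum (bsBefore du)) → bsBefore dv ⊑ bsBefore du →
            Star _⋖ᵛ_ u v
    climb du (acc smaller) dv⊑du with List.≡-dec ℕ._≟_ (bsBefore du) (bsBefore dv)
    ... | yes eq = subst (Star _⋖ᵛ_ _) (bsBefore-injective du dv eq) ε
    ... | no neq =
      let w , s , dw , bump , dv⊑dw = step-up du (bsBefore dv) (bsBefore-nondecreasing dv) dv⊑du (neq ∘ sym)
      in swapAscent⇒⋖ᵛ s ◅ climb dw (smaller (Bump⇒sum< bump)) dv⊑dw

  countBelow : Fin N → List (Fin N) → ℕ
  countBelow a = length ∘ List.filter (Fin._<? a)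

  countBelow-accept : b Fin.< a → countBelow a (b ∷ bs) ≡ suc (countBelow a bs)
  countBelow-accept b<a = cong length (List.filter-accept (Fin._<? _) b<a)

  countBelow-none : All (λ b → ¬ b Fin.< a) bs → countBelow a bs ≡ 0
  countBelow-none ≮a = cong length (List.filter-none (Fin._<? _) ≮a)

  countBelow-none⁻ : countBelow a bs ≡ 0 → All (λ b → ¬ b Fin.< a) bs
  countBelow-none⁻ {bs = bs} none = All.¬Any⇒All¬ bs λ some →
    ℕ.<-irrefl (sym none) (List.filter-some (Fin._<? _) some)

  countBelow-above : All (a Fin.<_) as → countBelow a as ≡ 0
  countBelow-above = countBelow-none ∘ All.map (λ a<x x<a → Fin.<-asym a<x x<a)

  countBelow-++ : ∀ xs → countBelow a (xs ++ bs) ≡ countBelow a xs + countBelow a bs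
  countBelow-++ {a} {bs} xs =
    trans (cong length (List.filter-++ (Fin._<? a) xs bs)) (List.length-++ (List.filter (Fin._<? a) xs))

  countBelow-mono : a Fin.< b → countBelow a bs ≤ countBelow b bs
  countBelow-mono {bs = bs} a<b = Sublist.length-mono-≤ (Sublist.filter⁺ (Fin._<? _) (Fin._<? _)
    (λ { refl x<a → Fin.<-trans x<a a<b }) (Sublist.⊆-reflexive (refl {x = bs})))

  -- The entries of the Lehmer code of as ++ bs at the positions of as.
  inversionCounts : List (Fin N) → List (Fin N) → List ℕ
  inversionCounts as bs = map (λ a → countBelow a bs) as

  inversionCounts-right : All (b Fin.<_) as → inversionCounts as (b ∷ bs) ≡ map suc (inversionCounts as bs)
  inversionCounts-right []           = refl
  inversionCounts-right (b<a ∷ b<as) = cong₂ _∷_ (countBelow-accept b<a) (inversionCounts-right b<as)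

  inversionCounts-nondecreasing : Ascending as → NonDecreasing (inversionCounts as bs)
  inversionCounts-nondecreasing {bs = bs} = AllPairs.map⁺ ∘ AllPairs.map (countBelow-mono {bs = bs})

  bsBefore-⊑-inversionCounts : (d : Shuffle as bs u) → bsBefore d ⊑ inversionCounts as bs
  bsBefore-⊑-inversionCounts []             = []
  bsBefore-⊑-inversionCounts (left d)       = z≤n ∷ bsBefore-⊑-inversionCounts d
  bsBefore-⊑-inversionCounts (right b<as d) =
    subst (_ ⊑_) (sym (inversionCounts-right b<as)) (map-suc-⊑ (bsBefore-⊑-inversionCounts d))

  bsBefore-surjective : Ascending as → Ascending bs →
                        (c : List ℕ) → NonDecreasing c → c ⊑ inversionCounts as bs →
                        ∃ λ m → Σ[ u ∈ Vec (Fin N) m ] Σ[ d ∈ Shuffle as bs u ] bsBefore d ≡ c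
  bsBefore-surjective {as = []} {bs} _ _ [] _ [] = _ , _ , onlyBs bs , bsBefore-noAs (onlyBs bs)
    where
    onlyBs : (bs : List (Fin N)) → Shuffle [] bs (Vec.fromList bs)
    onlyBs []       = []
    onlyBs (b ∷ bs) = right [] (onlyBs bs)
  bsBefore-surjective (_ ∷ <as) <bs (0 ∷ c) (_ ∷ nd) (_ ∷ c⊑) =
    let _ , _ , d , eq = bsBefore-surjective <as <bs c nd c⊑ in _ , _ , left d , cong (0 ∷_) eq
  bsBefore-surjective {a ∷ as} {[]} _ _ (suc _ ∷ _) _ (() ∷ _)
  bsBefore-surjective {a ∷ as} {b ∷ bs} (a<as ∷ <as) (b<bs ∷ <bs) c@(suc _ ∷ _) nd c⊑ with b Fin.<? a
  ... | no b≮a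
    with () ← subst (_ ≤_) (countBelow-none (b≮a ∷ All.map (λ b<x x<a → b≮a (Fin.<-trans b<x x<a)) b<bs))
                           (Pointwise.head c⊑)
  ... | yes b<a =
    let b<as = b<a ∷ All.map (Fin.<-trans b<a) a<as
        c₀ , c≡ = positive⇒map-suc nd
        _ , _ , d , eq = bsBefore-surjective (a<as ∷ <as) <bs c₀
          (nonDecreasing-map-suc⁻ (subst NonDecreasing c≡ nd))
          (map-suc-⊑⁻ (subst₂ _⊑_ c≡ (inversionCounts-right b<as) c⊑))
    in _ , _ , right b<as d , trans (cong (map suc) eq) (sym c≡)

  shuffle-All : ∀ {P : Fin N → Set} → All P as → All P bs → Shuffle as bs u → All P (Vec.toList u)
  shuffle-All []         []         []          = []
  shuffle-All (pa ∷ pas) pbs        (left d)    = pa ∷ shuffle-All pas pbs d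
  shuffle-All pas        (pb ∷ pbs) (right _ d) = pb ∷ shuffle-All pas pbs d

  -- In the shuffle with the largest counts every a is preceded by all b < a, so it is sorted.
  maximal-shuffle-ascending : Ascending as → Ascending bs → Disjoint as bs → (d : Shuffle as bs u) →
                              bsBefore d ≡ inversionCounts as bs → Ascending (Vec.toList u)
  maximal-shuffle-ascending _ _ _ [] _ = []
  maximal-shuffle-ascending {bs = bs} (a<as ∷ <as) <bs as#bs (left {a = a} d) eq =
    shuffle-All a<as a<bs d ∷ maximal-shuffle-ascending <as <bs (contractₗ as#bs) d (List.∷-injectiveʳ eq)
    where
    a<bs : All (a Fin.<_) bs
    a<bs = All.zipWith (λ (b≮a , a≢b) → Fin.≤∧≢⇒< (ℕ.≮⇒≥ b≮a) a≢b)
      (countBelow-none⁻ (sym (List.∷-injectiveˡ eq)) , All.head (Disjoint.Disjoint⇒AllAll as#bs))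
  maximal-shuffle-ascending <as (b<bs ∷ <bs) as#bs (right b<as d) eq =
    shuffle-All b<as b<bs d ∷ maximal-shuffle-ascending <as <bs (contractᵣ as#bs) d
      (List.map-injective ℕ.suc-injective (trans eq (inversionCounts-right b<as)))

  ascending-bound : ∀ {x} (v : Vec (Fin N) m) → Ascending (Vec.toList (x ∷ v)) → toℕ x + m < N
  ascending-bound {x = x} [] _ = subst (_< N) (sym (ℕ.+-identityʳ _)) (Fin.toℕ<n x)
  ascending-bound {suc m} {x} (y ∷ v) ((x<y ∷ _) ∷ <v) = begin-strict
    toℕ x + suc m   ≡⟨ ℕ.+-suc (toℕ x) m ⟩
    suc (toℕ x) + m ≤⟨ ℕ.+-monoˡ-≤ m x<y ⟩
    toℕ y + m       <⟨ ascending-bound v <v ⟩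
    N               ∎
    where open ℕ.≤-Reasoning

  ascending-from : ∀ c (v : Vec (Fin N) m) → Ascending (Vec.toList v) → All (λ x → c ≤ toℕ x) (Vec.toList v) →
                   N ≤ m + c → ∀ i → toℕ (lookup v i) ≡ c + toℕ i
  ascending-from {suc m} c (x ∷ v) <xv@(x<v ∷ <v) (c≤x ∷ _) N≤ = from-x
    where
    x≡c : toℕ x ≡ c
    x≡c = ℕ.≤-antisym (ℕ.+-cancelʳ-≤ m (toℕ x) c (begin
      toℕ x + m ≤⟨ ℕ.≤-pred (ℕ.≤-trans (ascending-bound v <xv) N≤) ⟩
      m + c     ≡⟨ ℕ.+-comm m c ⟩
      c + m     ∎)) c≤x
      where open ℕ.≤-Reasoning
    from-x : ∀ i → toℕ (lookup (x ∷ v) i) ≡ c + toℕ i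
    from-x zero    = trans x≡c (sym (ℕ.+-identityʳ c))
    from-x (suc i) = trans
      (ascending-from (suc c) v <v (All.map (λ {y} → subst (_≤ toℕ y) (cong suc x≡c)) x<v)
        (subst (N ≤_) (sym (ℕ.+-suc m c)) N≤) i)
      (sym (ℕ.+-suc c (toℕ i)))

  ascending⇒allFin : (v : Vec (Fin N) N) → Ascending (Vec.toList v) → v ≡ Vec.allFin N
  ascending⇒allFin v <v = lookup-ext λ i → Fin.toℕ-injective (begin
    toℕ (lookup v i)              ≡⟨ ascending-from 0 v <v (All.universal (λ _ → z≤n) _) N≤N+0 i ⟩
    toℕ i                         ≡⟨ cong toℕ (Vec.lookup-allFin i) ⟨
    toℕ (lookup (Vec.allFin N) i) ∎)
    where
    open ≡-Reasoning
    N≤N+0 : N ≤ N + 0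
    N≤N+0 = ℕ.≤-reflexive (sym (ℕ.+-identityʳ N))

  -- Lehmer codes and descents

  inversionAfter? : (w : Vec (Fin N) m) (i : Fin m) →
                    Decidable (λ j → i Fin.< j × lookup w j Fin.< lookup w i)
  inversionAfter? w i j = (i Fin.<? j) ×-dec (lookup w j Fin.<? lookup w i)

  lehmerCode : Vec (Fin N) m → Vec ℕ m
  lehmerCode {m} w = Vec.tabulate λ i → Vec.count (inversionAfter? w i) (Vec.allFin m)

  lehmerCodeList : List (Fin N) → List ℕ
  lehmerCodeList []       = []
  lehmerCodeList (a ∷ as) = countBelow a as ∷ lehmerCodeList as

  lehmerCode-toList : (w : Vec (Fin N) m) → Vec.toList (lehmerCode w) ≡ lehmerCodeList (Vec.toList w)
  lehmerCode-toList []              = refl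
  lehmerCode-toList {suc m} (x ∷ v) = cong₂ _∷_
    (trans (count-allFin-suc (inversionAfter? (x ∷ v) zero) ((Fin._<? x) ∘ lookup v) refl (λ _ → refl))
      (trans (count-lookup (Fin._<? x) v) (count≡length-filter (Fin._<? x) v)))
    (trans (cong Vec.toList (Vec.tabulate-cong λ i →
      count-allFin-suc (inversionAfter? (x ∷ v) (suc i)) (inversionAfter? v i) refl (λ _ → refl)))
      (lehmerCode-toList v))

  lehmerCodeList-ascending : Ascending as → lehmerCodeList as ≡ replicate (length as) 0
  lehmerCodeList-ascending []           = refl
  lehmerCodeList-ascending (a<as ∷ <as) = cong₂ _∷_ (countBelow-above a<as) (lehmerCodeList-ascending <as)

  lehmerCodeList-++ : Ascending as → Ascending bs →
                      lehmerCodeList (as ++ bs) ≡ inversionCounts as bs ++ replicate (length bs) 0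
  lehmerCodeList-++ []                      <bs = lehmerCodeList-ascending <bs
  lehmerCodeList-++ {a ∷ as} (a<as ∷ <as) <bs = cong₂ _∷_
    (trans (countBelow-++ as) (cong (_+ _) (countBelow-above a<as)))
    (lehmerCodeList-++ <as <bs)

  DescentAt : Vec (Fin N) m → Fin m → Set
  DescentAt {m} w i = Σ (Fin m) λ j → (toℕ j ≡ suc (toℕ i)) × (lookup w j Fin.< lookup w i)

  AtMostOneDescent : Vec (Fin N) m → Set
  AtMostOneDescent w = ∀ i i′ → DescentAt w i → DescentAt w i′ → i ≡ i′

  InjectiveWord : Vec (Fin N) m → Set
  InjectiveWord w = Injective _≡_ _≡_ (lookup w)

  descentAt-suc : ∀ {i} → DescentAt v i → DescentAt (a ∷ v) (suc i)
  descentAt-suc (j , j≡1+i , lt) = suc j , cong suc j≡1+i , lt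

  injectiveWord-tail : InjectiveWord (a ∷ v) → InjectiveWord v
  injectiveWord-tail inj = Fin.suc-injective ∘ inj

  injectiveWord⇒unique : (v : Vec (Fin N) m) → InjectiveWord v → Unique (Vec.toList v)
  injectiveWord⇒unique []      _   = []
  injectiveWord⇒unique (x ∷ v) inj =
    VecAll.toList⁺ (VecAll.lookup⁻ λ j x≡vj → case inj {zero} {suc j} x≡vj of λ ())
    ∷ injectiveWord⇒unique v (injectiveWord-tail inj)

  atMostOneDescent-tail : AtMostOneDescent (a ∷ v) → AtMostOneDescent v
  atMostOneDescent-tail one i i′ d d′ =
    Fin.suc-injective (one (suc i) (suc i′) (descentAt-suc d) (descentAt-suc d′))

  ascending-∷ : a Fin.< b → Ascending (b ∷ as) → Ascending (a ∷ b ∷ as)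
  ascending-∷ a<b <bas@(b<as ∷ _) = (a<b ∷ All.map (Fin.<-trans a<b) b<as) ∷ <bas

  no-descent⇒ascending : (v : Vec (Fin N) m) → InjectiveWord v → (∀ i → ¬ DescentAt v i) →
                         Ascending (Vec.toList v)
  no-descent⇒ascending []      _ _ = []
  no-descent⇒ascending (x ∷ []) _ _ = [] ∷ []
  no-descent⇒ascending (x ∷ yv@(y ∷ _)) inj none
    with no-descent⇒ascending yv (injectiveWord-tail inj) (λ i → none (suc i) ∘ descentAt-suc) | Fin.<-cmp x y
  ... | <yv | tri< x<y _ _ = ascending-∷ x<y <yv
  ... | _   | tri≈ _ x≡y _ with () ← inj {zero} {suc zero} x≡y
  ... | _   | tri> _ _ y<x = ⊥-elim (none zero (suc zero , refl , y<x))

  grassmannian-split : (v : Vec (Fin N) m) → InjectiveWord v → AtMostOneDescent v →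
                       ∃₂ λ as bs → Vec.toList v ≡ as ++ bs × Ascending as × Ascending bs
  grassmannian-split []       _ _ = [] , [] , refl , [] , []
  grassmannian-split (x ∷ []) _ _ = x ∷ [] , [] , refl , [] ∷ [] , []
  grassmannian-split (x ∷ yv@(y ∷ _)) inj one
    with grassmannian-split yv (injectiveWord-tail inj) (atMostOneDescent-tail one) | Fin.<-cmp x y
  ... | _ | tri≈ _ x≡y _ with () ← inj {zero} {suc zero} x≡y
  ... | _ | tri> _ _ y<x = x ∷ [] , Vec.toList yv , refl , [] ∷ [] ,
        no-descent⇒ascending yv (injectiveWord-tail inj)
          (λ i d → case one zero (suc i) (suc zero , refl , y<x) (descentAt-suc d) of λ ())
  ... | [] , bs , yv≡bs , _ , <bs | tri< _ _ _ = x ∷ [] , bs , cong (x ∷_) yv≡bs , [] ∷ [] , <bs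
  ... | a ∷ as , bs , yv≡as++bs , <as , <bs | tri< x<y _ _ with refl ← List.∷-injectiveˡ yv≡as++bs =
    x ∷ a ∷ as , bs , cong (x ∷_) yv≡as++bs , ascending-∷ x<y <as , <bs

-- Partitions

⊆Y⇒⊑ : {μ ν : Vec ℕ m} → μ ⊆Y ν → Vec.toList μ ⊑ Vec.toList ν
⊆Y⇒⊑ {μ = []}    {[]}    _   = []
⊆Y⇒⊑ {μ = _ ∷ _} {_ ∷ _} μ⊆ν = μ⊆ν zero ∷ ⊆Y⇒⊑ (μ⊆ν ∘ suc)

⊑⇒⊆Y : {μ ν : Vec ℕ m} → Vec.toList μ ⊑ Vec.toList ν → μ ⊆Y ν
⊑⇒⊆Y {μ = _ ∷ _} {_ ∷ _} (x≤y ∷ _)   zero    = x≤y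
⊑⇒⊆Y {μ = _ ∷ _} {_ ∷ _} (_   ∷ μ⊑ν) (suc i) = ⊑⇒⊆Y μ⊑ν i

decreasing⇒nonIncreasing : (μ : Vec ℕ m) → Decreasing μ → NonIncreasing (Vec.toList μ)
decreasing⇒nonIncreasing []      _   = []
decreasing⇒nonIncreasing (x ∷ μ) dec =
  VecAll.toList⁺ (VecAll.lookup⁻ λ j → dec zero (suc j) z≤n)
  ∷ decreasing⇒nonIncreasing μ (λ i j i≤j → dec (suc i) (suc j) (s≤s i≤j))

nonIncreasing⇒decreasing : (μ : Vec ℕ m) → NonIncreasing (Vec.toList μ) → Decreasing μ
nonIncreasing⇒decreasing (x ∷ μ) _         zero    zero    _         = ℕ.≤-refl
nonIncreasing⇒decreasing (x ∷ μ) (x≥μ ∷ _) zero    (suc j) _         = VecAll.lookup⁺ (VecAll.toList⁻ x≥μ) j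
nonIncreasing⇒decreasing (x ∷ μ) (_ ∷ ni)  (suc i) (suc j) (s≤s i≤j) = nonIncreasing⇒decreasing μ ni i j i≤j

-- bsBefore increases along as while the parts of a partition decrease, hence the reversal.
youngList : ℕ → List ℕ → List ℕ
youngList q c = reverse c ++ replicate q 0

youngList-nonIncreasing : ∀ q {c} → NonDecreasing c → NonIncreasing (youngList q c)
youngList-nonIncreasing q {c} nd =
  AllPairs.++⁺ (AllPairs-reverse nd) (zeros q) (All.universal (λ _ → All.replicate⁺ q z≤n) (reverse c))
  where
  zeros : ∀ q → NonIncreasing (replicate q 0)
  zeros zero    = []
  zeros (suc q) = All.replicate⁺ q z≤n ∷ zeros q

youngList-mono : ∀ q → xs ⊑ ys → youngList q xs ⊑ youngList q ys
youngList-mono q xs⊑ys = Pointwise.++⁺ (Pointwise.reverse⁺ xs⊑ys) ⊑-refl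

youngList-mono⁻ : ∀ q → youngList q xs ⊑ youngList q ys → xs ⊑ ys
youngList-mono⁻ {xs} {ys} q ⊑y = subst₂ _⊑_ (List.reverse-involutive xs) (List.reverse-involutive ys)
  (Pointwise.reverse⁺ (Pointwise.++-cancelʳ (reverse xs) (reverse ys) ⊑y))

youngList-injective : ∀ q → youngList q xs ≡ youngList q ys → xs ≡ ys
youngList-injective {xs} {ys} q =
  List.reverse-injective ∘ List.++-cancelʳ (replicate q 0) (reverse xs) (reverse ys)

youngList-below : ∀ q {μ β} → NonIncreasing μ → μ ⊑ youngList q β →
                  ∃ λ c → μ ≡ youngList q c × NonDecreasing c × c ⊑ β
youngList-below q {β = β} ni μ⊑ with ⊑-++⁻ (reverse β) (replicate q 0) μ⊑
... | μ₁ , μ₂ , refl , μ₁⊑ , μ₂⊑ rewrite ⊑-replicate-0 q μ₂⊑ =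
  reverse μ₁ , cong (_++ _) (sym (List.reverse-involutive μ₁)) ,
  AllPairs-reverse (AllPairs-++⁻ˡ μ₁ ni) ,
  subst (reverse μ₁ ⊑_) (List.reverse-involutive β) (Pointwise.reverse⁺ μ₁⊑)

shape-youngList : ∀ {n} {w : Word n} {λ′ as bs} → IsShape w λ′ → Vec.toList w ≡ as ++ bs →
                  Ascending as → Ascending bs → Vec.toList λ′ ≡ youngList (length bs) (inversionCounts as bs)
shape-youngList {w = w} {λ′} {as} {bs} (dec , λ↭code) w≡ <as <bs =
  nonIncreasing-↭-unique (decreasing⇒nonIncreasing λ′ dec)
    (youngList-nonIncreasing (length bs) (inversionCounts-nondecreasing {bs = bs} <as)) (begin
      Vec.toList λ′                                    ↭⟨ λ↭code ⟩
      Vec.toList (code w)                              ≡⟨ lehmerCode-toList w ⟩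
      lehmerCodeList (Vec.toList w)                    ≡⟨ cong lehmerCodeList w≡ ⟩
      lehmerCodeList (as ++ bs)                        ≡⟨ lehmerCodeList-++ <as <bs ⟩
      inversionCounts as bs ++ replicate (length bs) 0 ↭⟨ Perm.++⁺ʳ (replicate (length bs) 0)
                                                            (↭-sym (Perm.↭-reverse (inversionCounts as bs))) ⟩
      youngList (length bs) (inversionCounts as bs)    ∎)
  where open Perm.PermutationReasoning

module _ {n : ℕ} {w : Word n} {as bs : List (Fin n)} (w≡ : Vec.toList w ≡ as ++ bs)
         (<as : Ascending as) (<bs : Ascending bs) (as#bs : Disjoint as bs)
         {λ′ : Vec ℕ n} (λ≡ : Vec.toList λ′ ≡ youngList (length bs) (inversionCounts as bs)) where

  private
    variable
      u v : Word n

    top : Σ[ d ∈ Shuffle as bs w ] bsBefore d ≡ replicate (length as) 0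
    top = concatenation-shuffle w w≡

    n≡ : n ≡ length as + length bs
    n≡ = shuffle-length (proj₁ top)

  youngList-length : (d : Shuffle as bs u) → length (youngList (length bs) (bsBefore d)) ≡ n
  youngList-length d = begin
    length (reverse (bsBefore d) ++ replicate (length bs) 0)         ≡⟨ List.length-++ (reverse (bsBefore d)) ⟩
    length (reverse (bsBefore d)) + length (replicate (length bs) 0) ≡⟨ cong₂ _+_
      (trans (List.length-reverse (bsBefore d)) (bsBefore-length d)) (List.length-replicate (length bs)) ⟩
    length as + length bs                                            ≡⟨ n≡ ⟨
    n                                                                ∎
    where open ≡-Reasoning

  youngVec : Shuffle as bs u → Vec ℕ n
  youngVec d = vecOfLength (youngList (length bs) (bsBefore d)) (youngList-length d)

  toList-youngVec : (d : Shuffle as bs u) → Vec.toList (youngVec d) ≡ youngList (length bs) (bsBefore d)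
  toList-youngVec d = toList-vecOfLength _ (youngList-length d)

  youngVec-cong : (d : Shuffle as bs u) (d′ : Shuffle as bs v) → bsBefore d ≡ bsBefore d′ →
                  youngVec d ≡ youngVec d′
  youngVec-cong d d′ eq =
    toList-injective (trans (toList-youngVec d) (trans (cong (youngList _) eq) (sym (toList-youngVec d′))))

  youngVec-injective : (d : Shuffle as bs u) (d′ : Shuffle as bs v) → youngVec d ≡ youngVec d′ →
                       bsBefore d ≡ bsBefore d′
  youngVec-injective d d′ eq =
    youngList-injective _ (trans (sym (toList-youngVec d)) (trans (cong Vec.toList eq) (toList-youngVec d′)))

  youngVec-⊆Y : (d : Shuffle as bs u) (d′ : Shuffle as bs v) → bsBefore d ⊑ bsBefore d′ →
                youngVec d ⊆Y youngVec d′
  youngVec-⊆Y d d′ = ⊑⇒⊆Y ∘ subst₂ _⊑_ (sym (toList-youngVec d)) (sym (toList-youngVec d′)) ∘ youngList-mono _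

  youngVec-⊆Y⁻ : (d : Shuffle as bs u) (d′ : Shuffle as bs v) → youngVec d ⊆Y youngVec d′ →
                 bsBefore d ⊑ bsBefore d′
  youngVec-⊆Y⁻ d d′ = youngList-mono⁻ _ ∘ subst₂ _⊑_ (toList-youngVec d) (toList-youngVec d′) ∘ ⊆Y⇒⊑

  youngVec-inYoungInterval : (d : Shuffle as bs u) → Decreasing (youngVec d) × youngVec d ⊆Y λ′
  youngVec-inYoungInterval d =
    nonIncreasing⇒decreasing _ (subst NonIncreasing (sym (toList-youngVec d))
      (youngList-nonIncreasing _ (bsBefore-nondecreasing d))) ,
    ⊑⇒⊆Y (subst₂ _⊑_ (sym (toList-youngVec d)) (sym λ≡) (youngList-mono _ (bsBefore-⊑-inversionCounts d)))

  wordWithBsBefore : ∀ {c} → NonDecreasing c → c ⊑ inversionCounts as bs →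
                     Σ[ u ∈ Word n ] Σ[ d ∈ Shuffle as bs u ] bsBefore d ≡ c
  wordWithBsBefore nd c⊑ with _ , u , d , eq ← bsBefore-surjective <as <bs _ nd c⊑
    with refl ← trans (shuffle-length d) (sym n≡) = u , d , eq

  identity-shuffle : Σ[ d ∈ Shuffle as bs (e n) ] bsBefore d ≡ inversionCounts as bs
  identity-shuffle with u , d , eq ← wordWithBsBefore (inversionCounts-nondecreasing {bs = bs} <as) ⊑-refl
    with refl ← ascending⇒allFin u (maximal-shuffle-ascending <as <bs as#bs d eq) = d , eq

  shuffle-inWeakInterval : Shuffle as bs u → e n ≤R u × u ≤R w
  shuffle-inWeakInterval d =
    bsBefore-⊑⇒≤R (proj₁ identity-shuffle) d
      (subst (bsBefore d ⊑_) (sym (proj₂ identity-shuffle)) (bsBefore-⊑-inversionCounts d)) ,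
    bsBefore-⊑⇒≤R d (proj₁ top)
      (subst (_⊑ bsBefore d) (trans (cong (λ k → replicate k 0) (bsBefore-length d)) (sym (proj₂ top)))
        (replicate-0-⊑ (bsBefore d)))

  shuffleOf : (x : WeakInterval n w) → Shuffle as bs (proj₁ x)
  shuffleOf (_ , _ , u≤w) = proj₁ (shuffle-below <as <bs u≤w (proj₁ top))

  toYoung : WeakInterval n w → YoungInterval n λ′
  toYoung x = youngVec (shuffleOf x) , youngVec-inYoungInterval (shuffleOf x)

  toYoung-cong : (x y : WeakInterval n w) → _≈W_ {n} {w} x y → _≈Y_ {n} {λ′} (toYoung x) (toYoung y)
  toYoung-cong x@(u , _) y@(.u , _) refl =
    youngVec-cong (shuffleOf x) (shuffleOf y) (bsBefore-unique as#bs (shuffleOf x) (shuffleOf y))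

  toYoung-mono : (x y : WeakInterval n w) → _≤W_ {n} {w} x y → _≤Y*_ {n} {λ′} (toYoung x) (toYoung y)
  toYoung-mono x y x≤y =
    let d , dy⊑d = shuffle-below <as <bs x≤y (shuffleOf y)
    in youngVec-⊆Y (shuffleOf y) (shuffleOf x)
         (subst (bsBefore (shuffleOf y) ⊑_) (bsBefore-unique as#bs d (shuffleOf x)) dy⊑d)

  toYoung-injective : (x y : WeakInterval n w) → _≈Y_ {n} {λ′} (toYoung x) (toYoung y) → _≈W_ {n} {w} x y
  toYoung-injective x y eq =
    bsBefore-injective (shuffleOf x) (shuffleOf y) (youngVec-injective (shuffleOf x) (shuffleOf y) eq)

  toYoung-cancel : (x y : WeakInterval n w) → _≤Y*_ {n} {λ′} (toYoung x) (toYoung y) → _≤W_ {n} {w} x y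
  toYoung-cancel x y y⊆x =
    bsBefore-⊑⇒≤R (shuffleOf x) (shuffleOf y) (youngVec-⊆Y⁻ (shuffleOf y) (shuffleOf x) y⊆x)

  toYoung-surjective : (μ : YoungInterval n λ′) →
                       ∃ λ x → ∀ {z} → _≈W_ {n} {w} z x → _≈Y_ {n} {λ′} (toYoung z) μ
  toYoung-surjective (μ , dec , μ⊆λ) =
    let c , μ≡ , nd , c⊑ = youngList-below (length bs) (decreasing⇒nonIncreasing μ dec)
                             (subst (Vec.toList μ ⊑_) λ≡ (⊆Y⇒⊑ μ⊆λ))
        u , d , d≡c = wordWithBsBefore nd c⊑
    in (u , shuffle-inWeakInterval d) , λ { {z@(.u , _)} refl → toList-injective (begin
         Vec.toList (youngVec (shuffleOf z))            ≡⟨ toList-youngVec (shuffleOf z) ⟩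
         youngList (length bs) (bsBefore (shuffleOf z)) ≡⟨ cong (youngList (length bs))
                                                             (bsBefore-unique as#bs (shuffleOf z) d) ⟩
         youngList (length bs) (bsBefore d)             ≡⟨ cong (youngList (length bs)) d≡c ⟩
         youngList (length bs) c                        ≡⟨ μ≡ ⟨
         Vec.toList μ                                   ∎) }
    where open ≡-Reasoning

  toYoung-isOrderIsomorphism :
    IsOrderIsomorphism (_≈W_ {n} {w}) (_≈Y_ {n} {λ′}) (_≤W_ {n} {w}) (_≤Y*_ {n} {λ′}) toYoung
  toYoung-isOrderIsomorphism = record
    { isOrderMonomorphism = record
      { isOrderHomomorphism = record { cong = λ {x y} → toYoung-cong x y ; mono = λ {x y} → toYoung-mono x y }
      ; injective           = λ {x y} → toYoung-injective x y
      ; cancel              = λ {x y} → toYoung-cancel x y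
      }
    ; surjective = toYoung-surjective
    }

proposition5p12 : ∀ (n : ℕ) (w : Word n) (λ′ : Vec ℕ n) →
    IsPerm w → Grassmannian w → IsShape w λ′ →
    Σ (WeakInterval n w → YoungInterval n λ′) λ f →
      IsOrderIsomorphism (_≈W_ {n} {w}) (_≈Y_ {n} {λ′}) (_≤W_ {n} {w}) (_≤Y*_ {n} {λ′}) f
proposition5p12 n w λ′ perm grass shape =
  let as , bs , w≡ , <as , <bs = grassmannian-split w perm grass
      as#bs = unique-++⇒disjoint as (subst Unique w≡ (injectiveWord⇒unique w perm))
      λ≡    = shape-youngList shape w≡ <as <bs
  in toYoung w≡ <as <bs as#bs λ≡ , toYoung-isOrderIsomorphism w≡ <as <bs as#bs λ≡
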